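{- Let $G$ be an $s$-regular graph of odd order. Then $r(G)\ge \frac{s}{2}$ and $\xi(G)\ge \frac{s}{2}$.
   Context: Graphs are finite, connected, may have multiple edges but no loops. The resistance $r(G)$ is the minimum number of edges that have to be removed from $G$ to obtain a $\Delta(G)$-edge-colorable subgraph. A 2-factorization of a $2n$-regular graph is a decomposition of its edge set into $n$ edge-disjoint 2-factors. For a 2-factorization $\mathcal F$, $o(\mathcal F)$ is the number of odd cycles in the 2-factors of $\mathcal F$. The oddness of an $s$-regular graph $G$ is: $\xi(G)=\min\{o(\mathcal F):\mathcal F \text{ a 2-factorization of } G\}$ if $s$ is even; $\xi(G)=\min\{\xi(G-F_1): F_1 \text{ a 1-factor of } G\}$ if $s$ is odd and $G$ has a 1-factor; and $\xi(G)=\infty$ otherwise. -}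

module Defs where

open import Data.Nat using (ℕ; zero; suc; _+_; _*_; _≤_; _%_; _≡ᵇ_; _<ᵇ_; _⊔_)
open import Data.Fin using (Fin; toℕ) renaming (zero to fzero; suc to fsuc)
open import Data.Fin.Properties using () renaming (_≟_ to _≟F_)
open import Data.Bool using (Bool; true; false; _∧_; _∨_; not; T; if_then_else_)
open import Data.Product using (Σ; ∃; _×_; _,_; proj₁; proj₂)
open import Data.Sum using (_⊎_)
open import Relation.Nullary using (¬_)
open import Relation.Nullary.Decidable using (⌊_⌋)
open import Relation.Binary.PropositionalEquality using (_≡_; _≢_)

record Multigraph : Set where
  field
    n        : ℕ
    m        : ℕ
    ends     : Fin m → Fin n × Fin n
    loopless : ∀ e → proj₁ (ends e) ≢ proj₂ (ends e)

open Multigraph public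

count : ∀ {k} → (Fin k → Bool) → ℕ
count {zero}  P = 0
count {suc k} P = (if P fzero then 1 else 0) + count {k} (λ i → P (fsuc i))

anyF : ∀ {k} → (Fin k → Bool) → Bool
anyF {zero}  P = false
anyF {suc k} P = P fzero ∨ anyF {k} (λ i → P (fsuc i))

allF : ∀ {k} → (Fin k → Bool) → Bool
allF {zero}  P = true
allF {suc k} P = P fzero ∧ allF {k} (λ i → P (fsuc i))

sumF : ∀ {k} → (Fin k → ℕ) → ℕ
sumF {zero}  f = 0
sumF {suc k} f = f fzero + sumF {k} (λ i → f (fsuc i))

maxF : ∀ {k} → (Fin k → ℕ) → ℕ
maxF {zero}  f = 0
maxF {suc k} f = f fzero ⊔ maxF {k} (λ i → f (fsuc i))

_==_ : ∀ {k} → Fin k → Fin k → Bool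
i == j = ⌊ i ≟F j ⌋

-- Spanning subgraphs are given by their edge sets  H : Fin m → Bool.

module _ (G : Multigraph) where

  EdgeSet : Set
  EdgeSet = Fin (m G) → Bool

  allEdges : EdgeSet
  allEdges _ = true

  incident : Fin (n G) → Fin (m G) → Bool
  incident v e = (proj₁ (ends G e) == v) ∨ (proj₂ (ends G e) == v)

  -- degree of v in the spanning subgraph with edge set H
  -- (edges are loopless, so each incident edge contributes exactly 1)
  deg : EdgeSet → Fin (n G) → ℕ
  deg H v = count (λ e → H e ∧ incident v e)

  Δ : ℕ
  Δ = maxF (deg allEdges)

  Regular : ℕ → Set
  Regular s = ∀ v → deg allEdges v ≡ s

  adj : EdgeSet → Fin (n G) → Fin (n G) → Bool
  adj H u v = anyF (λ e → H e ∧ (((proj₁ (ends G e) == u) ∧ (proj₂ (ends G e) == v))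
                                ∨ ((proj₁ (ends G e) == v) ∧ (proj₂ (ends G e) == u))))

  reachWithin : EdgeSet → ℕ → Fin (n G) → Fin (n G) → Bool
  reachWithin H zero    u v = u == v
  reachWithin H (suc k) u v =
    reachWithin H k u v ∨ anyF (λ w → reachWithin H k u w ∧ adj H w v)

  -- u and v lie in the same component of H (walks of length ≤ n suffice)
  reach : EdgeSet → Fin (n G) → Fin (n G) → Bool
  reach H = reachWithin H (n G)

  Connected : Set
  Connected = ∀ u v → T (reach allEdges u v)

  -- For a 2-factor H (components are cycles) this is the number of
  -- odd cycles of H.
  oddComponents : EdgeSet → ℕ
  oddComponents H = count (λ u →
      allF (λ w → not ((toℕ w <ᵇ toℕ u) ∧ reach H w u))
    ∧ (count (λ v → reach H u v) % 2 ≡ᵇ 1))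

  Adjacent : Fin (m G) → Fin (m G) → Set
  Adjacent e e' = e ≢ e' × T (anyF (λ v → incident v e ∧ incident v e'))

  EdgeColourable : EdgeSet → ℕ → Set
  EdgeColourable H k =
    Σ (Fin (m G) → Fin k) λ c →
      ∀ e e' → T (H e) → T (H e') → Adjacent e e' → c e ≢ c e'

  remove : EdgeSet → EdgeSet
  remove F e = not (F e)

  IsResistance : ℕ → Set
  IsResistance r =
      (Σ EdgeSet λ F → count F ≡ r × EdgeColourable (remove F) Δ)
    × (∀ F → EdgeColourable (remove F) Δ → r ≤ count F)

  OneFactor : EdgeSet → Set
  OneFactor F = ∀ v → deg F v ≡ 1

  factor : ∀ {k} → EdgeSet → (Fin (m G) → Fin k) → Fin k → EdgeSet
  factor H f i e = H e ∧ (f e == i)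

  -- f : E → Fin k is a 2-factorization of the spanning subgraph H
  -- (a 2k-regular graph) into k edge-disjoint 2-factors: the classes
  -- f⁻¹(i) ∩ H partition H and each is a 2-factor.
  TwoFactorization : (k : ℕ) → EdgeSet → (Fin (m G) → Fin k) → Set
  TwoFactorization k H f = ∀ i v → deg (factor H f i) v ≡ 2

  oddCycles : ∀ {k} → EdgeSet → (Fin (m G) → Fin k) → ℕ
  oddCycles H f = sumF (λ i → oddComponents (factor H f i))

data ℕ∞ : Set where
  fin : ℕ → ℕ∞
  ∞   : ℕ∞

data _≤∞_ : ℕ∞ → ℕ∞ → Set where
  fin≤fin : ∀ {a b} → a ≤ b → fin a ≤∞ fin b
  _≤∞∞    : ∀ x → x ≤∞ ∞

module _ (G : Multigraph) where

  -- x = min { o(F) : F a 2-factorization of H } for H 2k-regular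
  -- (x = ∞ if there is no 2-factorization, i.e. min over the empty set)
  IsOddnessEven : (k : ℕ) → EdgeSet G → ℕ∞ → Set
  IsOddnessEven k H (fin j) =
      (Σ (Fin (m G) → Fin k) λ f → TwoFactorization G k H f × oddCycles G H f ≡ j)
    × (∀ f → TwoFactorization G k H f → j ≤ oddCycles G H f)
  IsOddnessEven k H ∞ = ¬ (Σ (Fin (m G) → Fin k) λ f → TwoFactorization G k H f)

  -- x = ξ(G) for G (2k+1)-regular:
  -- min { ξ(G - F₁) : F₁ a 1-factor }, or ∞ if G has no 1-factor
  IsOddnessOdd : (k : ℕ) → ℕ∞ → Set
  IsOddnessOdd k x =
      ( (Σ (EdgeSet G) λ F₁ → OneFactor G F₁ × IsOddnessEven k (remove G F₁) x)
      × (∀ F₁ y → OneFactor G F₁ → IsOddnessEven k (remove G F₁) y → x ≤∞ y))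
    ⊎ (¬ (Σ (EdgeSet G) λ F₁ → OneFactor G F₁) × x ≡ ∞)

  IsOddness : ℕ → ℕ∞ → Set
  IsOddness s x =
      (∀ k → s ≡ 2 * k → IsOddnessEven k (allEdges G) x)
    × (∀ k → s ≡ suc (2 * k) → IsOddnessOdd k x)

-- Both bounds are parity arguments on the odd order n.  A colour class of a
-- proper edge colouring is a matching, so it covers an even number of
-- vertices and misses at least one: each of the Δ = s classes has at most
-- (n − 1)/2 edges, while G has sn/2 edges, so at least s/2 edges are left
-- uncoloured.  For oddness, s must be even (an odd-order graph has no
-- 1-factor); every spanning subgraph of a graph of odd order has a component
-- of odd order, so each of the s/2 factors of a 2-factorization contributes
-- an odd cycle.
module Submission where

open import Defs
open import Data.Nat using (ℕ; zero; suc; _+_; _*_; _≤_; _<_; _%_; _≡ᵇ_; _<ᵇ_; z≤n; s≤s)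
open import Data.Nat.Properties
open import Data.Nat.DivMod using (m%n<n)
open import Data.Nat.Divisibility using (_∣_; divides; m%n≡0⇒n∣m; n∣m⇒m%n≡0; _∣0; ∣m∣n⇒∣m+n)
open import Data.Fin using (Fin; toℕ) renaming (zero to fzero; suc to fsuc)
open import Data.Fin.Properties using (any?; toℕ-injective) renaming (_≟_ to _≟F_; suc-injective to fsuc-injective)
open import Data.Bool using (Bool; true; false; _∧_; _∨_; not; T; if_then_else_)
open import Data.Bool.Properties using (T?)
open import Data.Unit using (tt)
open import Data.Empty using (⊥-elim)
open import Data.Product using (∃; _×_; _,_; proj₁; proj₂)
open import Data.Sum using (_⊎_; inj₁; inj₂; [_,_])
open import Relation.Nullary using (¬_; yes; no)
open import Relation.Nullary.Decidable using (toWitness; fromWitness; decidable-stable; _×-dec_; ¬?)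
open import Relation.Binary.PropositionalEquality using (_≡_; _≢_; refl; sym; trans; cong; cong₂; subst; module ≡-Reasoning)
open import Relation.Binary.Definitions using (tri<; tri≈; tri>)
open import Algebra.Properties.CommutativeSemigroup +-commutativeSemigroup using (interchange)

T-∧⁻ : ∀ {a b} → T (a ∧ b) → T a × T b
T-∧⁻ {true} q = tt , q

T-∧⁺ : ∀ {a b} → T a → T b → T (a ∧ b)
T-∧⁺ {true} _ q = q

T-∨⁻ : ∀ {a b} → T (a ∨ b) → T a ⊎ T b
T-∨⁻ {true}  _ = inj₁ tt
T-∨⁻ {false} q = inj₂ q

T-∨⁺ˡ : ∀ {a b} → T a → T (a ∨ b)
T-∨⁺ˡ {true} _ = tt

T-∨⁺ʳ : ∀ {a b} → T b → T (a ∨ b)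
T-∨⁺ʳ {true}  _ = tt
T-∨⁺ʳ {false} q = q

T-∨-comm : ∀ a b → T (a ∨ b) → T (b ∨ a)
T-∨-comm a b p = [ T-∨⁺ʳ {b} , T-∨⁺ˡ ] (T-∨⁻ {a} p)

T-not⁺ : ∀ {a} → ¬ T a → T (not a)
T-not⁺ {true}  ¬a = ¬a tt
T-not⁺ {false} _  = tt

T-not⁻ : ∀ {a} → T (not a) → ¬ T a
T-not⁻ {false} _ ()

==⇒≡ : ∀ {k} {i j : Fin k} → T (i == j) → i ≡ j
==⇒≡ {i = i} {j} = toWitness {a? = i ≟F j}

==-refl : ∀ {k} (i : Fin k) → T (i == i)
==-refl i = fromWitness {a? = i ≟F i} refl

anyF-intro : ∀ {k} (P : Fin k → Bool) i → T (P i) → T (anyF P)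
anyF-intro P fzero    p = T-∨⁺ˡ p
anyF-intro P (fsuc i) p = T-∨⁺ʳ {P fzero} (anyF-intro (λ j → P (fsuc j)) i p)

anyF-elim : ∀ {k} (P : Fin k → Bool) → T (anyF P) → ∃ λ i → T (P i)
anyF-elim {suc k} P p with T-∨⁻ {P fzero} p
... | inj₁ p₀ = fzero , p₀
... | inj₂ ps with anyF-elim (λ j → P (fsuc j)) ps
...   | i , pᵢ = fsuc i , pᵢ

allF-intro : ∀ {k} (P : Fin k → Bool) → (∀ i → T (P i)) → T (allF P)
allF-intro {zero}  P all = tt
allF-intro {suc k} P all = T-∧⁺ (all fzero) (allF-intro (λ j → P (fsuc j)) (λ i → all (fsuc i)))

allF-elim : ∀ {k} (P : Fin k → Bool) → T (allF P) → ∀ i → T (P i)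
allF-elim P p fzero    = proj₁ (T-∧⁻ p)
allF-elim P p (fsuc i) = allF-elim (λ j → P (fsuc j)) (proj₂ (T-∧⁻ {P fzero} p)) i

least-witness : ∀ {k} (P : Fin k → Bool) i → T (P i) →
                ∃ λ j → T (P j) × (∀ w → toℕ w < toℕ j → ¬ T (P w))
least-witness {suc k} P i p with P fzero in eq
... | true = fzero , subst T (sym eq) tt , λ _ ()
least-witness {suc k} P fzero p | false = ⊥-elim (subst T eq p)
least-witness {suc k} P (fsuc i) p | false with least-witness (λ j → P (fsuc j)) i p
... | j , pⱼ , below = fsuc j , pⱼ , minimal
  where
  minimal : ∀ w → toℕ w < toℕ (fsuc j) → ¬ T (P w)
  minimal fzero    _         p₀ = subst T eq p₀
  minimal (fsuc w) (s≤s w<j) pw = below w w<j pw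

sumF-ext : ∀ {k} (f g : Fin k → ℕ) → (∀ i → f i ≡ g i) → sumF f ≡ sumF g
sumF-ext {zero}  f g f≗g = refl
sumF-ext {suc k} f g f≗g =
  cong₂ _+_ (f≗g fzero) (sumF-ext (λ j → f (fsuc j)) (λ j → g (fsuc j)) (λ i → f≗g (fsuc i)))

sumF-mono : ∀ {k} (f g : Fin k → ℕ) → (∀ i → f i ≤ g i) → sumF f ≤ sumF g
sumF-mono {zero}  f g f≤g = z≤n
sumF-mono {suc k} f g f≤g =
  +-mono-≤ (f≤g fzero) (sumF-mono (λ j → f (fsuc j)) (λ j → g (fsuc j)) (λ i → f≤g (fsuc i)))

sumF-+ : ∀ {k} (f g : Fin k → ℕ) → sumF (λ i → f i + g i) ≡ sumF f + sumF g
sumF-+ {zero}  f g = refl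
sumF-+ {suc k} f g = trans (cong (f fzero + g fzero +_) (sumF-+ (λ j → f (fsuc j)) (λ j → g (fsuc j))))
                           (interchange (f fzero) (g fzero) _ _)

sumF-const : ∀ {k} c → sumF {k} (λ _ → c) ≡ k * c
sumF-const {zero}  c = refl
sumF-const {suc k} c = cong (c +_) (sumF-const {k} c)

sumF-ones : ∀ k → sumF {k} (λ _ → 1) ≡ k
sumF-ones zero    = refl
sumF-ones (suc k) = cong suc (sumF-ones k)

sumF-scale : ∀ {k} a (f : Fin k → ℕ) → sumF (λ i → a * f i) ≡ a * sumF f
sumF-scale {zero}  a f = sym (*-zeroʳ a)
sumF-scale {suc k} a f = trans (cong (a * f fzero +_) (sumF-scale a (λ j → f (fsuc j))))
                               (sym (*-distribˡ-+ a (f fzero) _))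

sumF-swap : ∀ {a b} (f : Fin a → Fin b → ℕ) →
            sumF (λ i → sumF (λ j → f i j)) ≡ sumF (λ j → sumF (λ i → f i j))
sumF-swap {zero}  {b} f = sym (trans (sumF-const {b} 0) (*-zeroʳ b))
sumF-swap {suc a} f = trans (cong (sumF (f fzero) +_) (sumF-swap (λ i j → f (fsuc i) j)))
                            (sym (sumF-+ (f fzero) (λ j → sumF (λ i → f (fsuc i) j))))

sumF-∣ : ∀ {k d} (f : Fin k → ℕ) → (∀ i → d ∣ f i) → d ∣ sumF f
sumF-∣ {zero}  f d∣f = _ ∣0
sumF-∣ {suc k} f d∣f = ∣m∣n⇒∣m+n (d∣f fzero) (sumF-∣ (λ j → f (fsuc j)) (λ i → d∣f (fsuc i)))

maxF-ub : ∀ {k} (f : Fin k → ℕ) i → f i ≤ maxF f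
maxF-ub f fzero    = m≤m⊔n _ _
maxF-ub f (fsuc i) = ≤-trans (maxF-ub (λ j → f (fsuc j)) i) (m≤n⊔m (f fzero) _)

maxF-lub : ∀ {k} (f : Fin k → ℕ) c → (∀ i → f i ≤ c) → maxF f ≤ c
maxF-lub {zero}  f c f≤c = z≤n
maxF-lub {suc k} f c f≤c = ⊔-lub (f≤c fzero) (maxF-lub (λ j → f (fsuc j)) c (λ i → f≤c (fsuc i)))

count-sumF : ∀ {k} (P : Fin k → Bool) → count P ≡ sumF (λ i → if P i then 1 else 0)
count-sumF {zero}  P = refl
count-sumF {suc k} P = cong ((if P fzero then 1 else 0) +_) (count-sumF (λ j → P (fsuc j)))

sumF-count-swap : ∀ {a b} (Q : Fin a → Fin b → Bool) →
                  sumF (λ j → count (λ i → Q i j)) ≡ sumF (λ i → count (λ j → Q i j))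
sumF-count-swap Q = begin
  sumF (λ j → count (λ i → Q i j))                       ≡⟨ sumF-ext _ _ (λ j → count-sumF (λ i → Q i j)) ⟩
  sumF (λ j → sumF (λ i → if Q i j then 1 else 0))       ≡⟨ sumF-swap (λ j i → if Q i j then 1 else 0) ⟩
  sumF (λ i → sumF (λ j → if Q i j then 1 else 0))       ≡⟨ sumF-ext _ _ (λ i → sym (count-sumF (Q i))) ⟩
  sumF (λ i → count (λ j → Q i j))                       ∎
  where open ≡-Reasoning

count≤ : ∀ {k} (P : Fin k → Bool) → count P ≤ k
count≤ {zero}  P = z≤n
count≤ {suc k} P with P fzero
... | true  = s≤s (count≤ (λ j → P (fsuc j)))
... | false = m≤n⇒m≤1+n (count≤ (λ j → P (fsuc j)))

count-true : ∀ k → count {k} (λ _ → true) ≡ k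
count-true zero    = refl
count-true (suc k) = cong suc (count-true k)

count-pos : ∀ {k} (P : Fin k → Bool) i → T (P i) → 0 < count P
count-pos {suc k} P i p with P fzero in eq
... | true = s≤s z≤n
count-pos {suc k} P fzero    p | false = ⊥-elim (subst T eq p)
count-pos {suc k} P (fsuc i) p | false = count-pos (λ j → P (fsuc j)) i p

count-zero : ∀ {k} (P : Fin k → Bool) → (∀ i → ¬ T (P i)) → count P ≡ 0
count-zero {zero}  P none = refl
count-zero {suc k} P none with P fzero in eq
... | true  = ⊥-elim (none fzero (subst T (sym eq) tt))
... | false = count-zero (λ j → P (fsuc j)) (λ i → none (fsuc i))

count≤1 : ∀ {k} (P : Fin k → Bool) → (∀ i j → T (P i) → T (P j) → i ≡ j) → count P ≤ 1
count≤1 {zero}  P unique = z≤n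
count≤1 {suc k} P unique with P fzero in eq
... | true  = ≤-reflexive (cong suc (count-zero (λ j → P (fsuc j))
                (λ j pⱼ → 0≢1+n (cong toℕ (unique fzero (fsuc j) (subst T (sym eq) tt) pⱼ)))))
... | false = count≤1 (λ j → P (fsuc j)) (λ i j pᵢ pⱼ → fsuc-injective (unique (fsuc i) (fsuc j) pᵢ pⱼ))

count-one : ∀ {k} (P : Fin k → Bool) i → T (P i) → (∀ j → T (P j) → j ≡ i) → count P ≡ 1
count-one P i p only-i =
  ≤-antisym (count≤1 P (λ a b pa pb → trans (only-i a pa) (sym (only-i b pb)))) (count-pos P i p)

count-∧ˡ : ∀ {k} b (P : Fin k → Bool) → count (λ i → b ∧ P i) ≡ (if b then count P else 0)
count-∧ˡ true  P = refl
count-∧ˡ {k} false P = count-zero {k} (λ _ → false) (λ _ ())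

count-∨ : ∀ {k} (P Q : Fin k → Bool) → (∀ i → T (P i) → ¬ T (Q i)) →
          count (λ i → P i ∨ Q i) ≡ count P + count Q
count-∨ {zero}  P Q disjoint = refl
count-∨ {suc k} P Q disjoint with P fzero | Q fzero | disjoint fzero
... | true  | true  | d = ⊥-elim (d tt tt)
... | true  | false | _ = cong suc (count-∨ (λ j → P (fsuc j)) (λ j → Q (fsuc j)) (λ i → disjoint (fsuc i)))
... | false | true  | _ = trans (cong suc (count-∨ (λ j → P (fsuc j)) (λ j → Q (fsuc j)) (λ i → disjoint (fsuc i))))
                                (sym (+-suc _ _))
... | false | false | _ = count-∨ (λ j → P (fsuc j)) (λ j → Q (fsuc j)) (λ i → disjoint (fsuc i))

count-⊆ : ∀ {k} (P Q : Fin k → Bool) → (∀ i → T (P i) → T (Q i)) →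
          count Q ≡ count P + count (λ i → Q i ∧ not (P i))
count-⊆ {zero}  P Q P⊆Q = refl
count-⊆ {suc k} P Q P⊆Q with P fzero | Q fzero | P⊆Q fzero
... | true  | true  | _ = cong suc (count-⊆ (λ j → P (fsuc j)) (λ j → Q (fsuc j)) (λ i → P⊆Q (fsuc i)))
... | true  | false | q = ⊥-elim (q tt)
... | false | true  | _ = trans (cong suc (count-⊆ (λ j → P (fsuc j)) (λ j → Q (fsuc j)) (λ i → P⊆Q (fsuc i))))
                                (sym (+-suc _ _))
... | false | false | _ = count-⊆ (λ j → P (fsuc j)) (λ j → Q (fsuc j)) (λ i → P⊆Q (fsuc i))

count-⊂ : ∀ {k} (P Q : Fin k → Bool) → (∀ i → T (P i) → T (Q i)) →
          ∀ j → T (Q j) → ¬ T (P j) → count P < count Q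
count-⊂ P Q P⊆Q j qⱼ ¬pⱼ = subst (count P <_) (sym (count-⊆ P Q P⊆Q))
  (m<m+n (count P) (count-pos (λ i → Q i ∧ not (P i)) j (T-∧⁺ qⱼ (T-not⁺ ¬pⱼ))))

count-compl : ∀ {k} (P : Fin k → Bool) → count (λ i → not (P i)) + count P ≡ k
count-compl {zero}  P = refl
count-compl {suc k} P with P fzero
... | true  = trans (+-suc _ _) (cong suc (count-compl (λ j → P (fsuc j))))
... | false = cong suc (count-compl (λ j → P (fsuc j)))

count-fibres : ∀ {k l} (P : Fin k → Bool) (c : Fin k → Fin l) →
               count P ≡ sumF (λ i → count (λ e → P e ∧ (c e == i)))
count-fibres P c = begin
  count P                                        ≡⟨ count-sumF P ⟩
  sumF (λ e → if P e then 1 else 0)              ≡⟨ sumF-ext _ _ fibre ⟩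
  sumF (λ e → count (λ i → P e ∧ (c e == i)))    ≡⟨ sym (sumF-count-swap (λ e i → P e ∧ (c e == i))) ⟩
  sumF (λ i → count (λ e → P e ∧ (c e == i)))    ∎
  where
  open ≡-Reasoning
  fibre : ∀ e → (if P e then 1 else 0) ≡ count (λ i → P e ∧ (c e == i))
  fibre e = trans (cong (λ x → if P e then x else 0)
                        (sym (count-one (c e ==_) (c e) (==-refl (c e)) (λ j p → sym (==⇒≡ p)))))
                  (sym (count-∧ˡ (P e) (c e ==_)))

odd⇒¬2∣ : ∀ {n} → n % 2 ≡ 1 → ¬ 2 ∣ n
odd⇒¬2∣ {n} odd 2∣n = 1+n≢0 (trans (sym odd) (n∣m⇒m%n≡0 n 2 2∣n))

¬odd⇒2∣ : ∀ n → n % 2 ≢ 1 → 2 ∣ n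
¬odd⇒2∣ n n%2≢1 = m%n≡0⇒n∣m n 2 (remainder (n % 2) (m%n<n n 2) n%2≢1)
  where
  remainder : ∀ r → r < 2 → r ≢ 1 → r ≡ 0
  remainder zero          _                 _   = refl
  remainder (suc zero)    _                 r≢1 = ⊥-elim (r≢1 refl)
  remainder (suc (suc _)) (s≤s (s≤s ()))

odd⇒Fin : ∀ {n} → n % 2 ≡ 1 → Fin n
odd⇒Fin {suc _} _ = fzero

even≤odd⇒< : ∀ {x n} → n % 2 ≡ 1 → 2 * x ≤ n → 2 * x < n
even≤odd⇒< {x} odd 2x≤n with m≤n⇒m<n∨m≡n 2x≤n
... | inj₁ 2x<n = 2x<n
... | inj₂ 2x≡n = ⊥-elim (odd⇒¬2∣ odd (divides x (trans (sym 2x≡n) (*-comm 2 x))))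

half : ∀ s → ∃ λ k → s ≡ 2 * k ⊎ s ≡ suc (2 * k)
half zero = 0 , inj₁ refl
half (suc s) with half s
... | k , inj₁ s≡2k  = k , inj₂ (cong suc s≡2k)
... | k , inj₂ s≡2k+1 = suc k , inj₁ (trans (cong suc s≡2k+1) (sym (*-suc 2 k)))

module _ (G : Multigraph) where

  count-incident : ∀ e → count (λ v → incident G v e) ≡ 2
  count-incident e =
    trans (count-∨ (u ==_) (v ==_) (λ w u≡w v≡w → loopless G e (trans (==⇒≡ u≡w) (sym (==⇒≡ v≡w)))))
          (cong₂ _+_ (count-one (u ==_) u (==-refl u) (λ _ p → sym (==⇒≡ p)))
                     (count-one (v ==_) v (==-refl v) (λ _ p → sym (==⇒≡ p))))
    where
    u v : Fin (n G)
    u = proj₁ (ends G e)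
    v = proj₂ (ends G e)

  handshake : ∀ H → sumF (deg G H) ≡ 2 * count H
  handshake H = begin
    sumF (deg G H)                                              ≡⟨ sumF-count-swap (λ e v → H e ∧ incident G v e) ⟩
    sumF (λ e → count (λ v → H e ∧ incident G v e))             ≡⟨ sumF-ext _ _ edge-ends ⟩
    sumF (λ e → 2 * (if H e then 1 else 0))                     ≡⟨ sumF-scale 2 (λ e → if H e then 1 else 0) ⟩
    2 * sumF (λ e → if H e then 1 else 0)                       ≡⟨ cong (2 *_) (sym (count-sumF H)) ⟩
    2 * count H                                                 ∎
    where
    open ≡-Reasoning
    edge-ends : ∀ e → count (λ v → H e ∧ incident G v e) ≡ 2 * (if H e then 1 else 0)
    edge-ends e with H e
    ... | true  = count-incident e
    ... | false = count-zero {n G} (λ _ → false) (λ _ ())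

  odd⇒no-1-factor : n G % 2 ≡ 1 → ∀ F → ¬ OneFactor G F
  odd⇒no-1-factor odd F perfect = odd⇒¬2∣ odd (divides (count F) (begin
    n G                     ≡⟨ sym (sumF-ones (n G)) ⟩
    sumF {n G} (λ _ → 1)    ≡⟨ sumF-ext _ _ (λ v → sym (perfect v)) ⟩
    sumF (deg G F)          ≡⟨ handshake F ⟩
    2 * count F             ≡⟨ *-comm 2 (count F) ⟩
    count F * 2             ∎))
    where open ≡-Reasoning

  matching-size : ∀ M → (∀ v → deg G M v ≤ 1) → n G % 2 ≡ 1 → 2 * count M < n G
  matching-size M deg≤1 odd = even≤odd⇒< {count M} odd (begin
    2 * count M             ≡⟨ sym (handshake M) ⟩
    sumF (deg G M)          ≤⟨ sumF-mono _ _ deg≤1 ⟩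
    sumF {n G} (λ _ → 1)    ≡⟨ sumF-ones (n G) ⟩
    n G                     ∎)
    where open ≤-Reasoning

  colour-class-matching : ∀ {k H} (col : EdgeColourable G H k) i v → deg G (factor G H (proj₁ col) i) v ≤ 1
  colour-class-matching {k} {H} (c , proper) i v = count≤1 _ same-edge
    where
    same-edge : ∀ e e' → T ((H e ∧ (c e == i)) ∧ incident G v e) → T ((H e' ∧ (c e' == i)) ∧ incident G v e') →
                e ≡ e'
    same-edge e e' p p' with T-∧⁻ {H e ∧ (c e == i)} p | T-∧⁻ {H e' ∧ (c e' == i)} p'
    ... | e∈Mᵢ , v∈e | e'∈Mᵢ , v∈e' with T-∧⁻ {H e} e∈Mᵢ | T-∧⁻ {H e'} e'∈Mᵢ | e ≟F e'
    ...   | _ , _ | _ , _ | yes e≡e' = e≡e'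
    ...   | e∈H , ce≡i | e'∈H , ce'≡i | no e≢e' =
      ⊥-elim (proper e e' e∈H e'∈H (e≢e' , anyF-intro (λ w → incident G w e ∧ incident G w e') v (T-∧⁺ v∈e v∈e'))
                     (trans (==⇒≡ ce≡i) (sym (==⇒≡ ce'≡i))))

  colourable-size : ∀ {k} H → EdgeColourable G H k → n G % 2 ≡ 1 → k + 2 * count H ≤ k * n G
  colourable-size {k} H col@(c , _) odd = begin
    k + 2 * count H                                       ≡⟨ cong₂ _+_ (sym (sumF-ones k)) (cong (2 *_) (count-fibres H c)) ⟩
    sumF {k} (λ _ → 1) + 2 * sumF (λ i → count (M i))     ≡⟨ cong (sumF {k} (λ _ → 1) +_) (sym (sumF-scale 2 (λ i → count (M i)))) ⟩
    sumF {k} (λ _ → 1) + sumF (λ i → 2 * count (M i))     ≡⟨ sym (sumF-+ {k} (λ _ → 1) (λ i → 2 * count (M i))) ⟩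
    sumF (λ i → suc (2 * count (M i)))                    ≤⟨ sumF-mono _ _ class-size ⟩
    sumF {k} (λ _ → n G)                                  ≡⟨ sumF-const {k} (n G) ⟩
    k * n G                                               ∎
    where
    open ≤-Reasoning
    M : Fin k → EdgeSet G
    M = factor G H c
    class-size : ∀ i → suc (2 * count (M i)) ≤ n G
    class-size i = matching-size (M i) (colour-class-matching col i) odd

  regular⇒Δ≡ : ∀ {s} → Regular G s → Fin (n G) → Δ G ≡ s
  regular⇒Δ≡ reg v = ≤-antisym (maxF-lub _ _ (λ u → ≤-reflexive (reg u)))
                               (subst (_≤ Δ G) (reg v) (maxF-ub _ v))

  regular-size : ∀ {s} → Regular G s → 2 * m G ≡ n G * s
  regular-size {s} reg = begin
    2 * m G                      ≡⟨ cong (2 *_) (sym (count-true (m G))) ⟩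
    2 * count (allEdges G)       ≡⟨ sym (handshake (allEdges G)) ⟩
    sumF (deg G (allEdges G))    ≡⟨ sumF-ext _ _ reg ⟩
    sumF {n G} (λ _ → s)         ≡⟨ sumF-const {n G} s ⟩
    n G * s                      ∎
    where open ≡-Reasoning

  resistance-bound : ∀ {s r} → Regular G s → n G % 2 ≡ 1 → IsResistance G r → s ≤ 2 * r
  resistance-bound {s} reg odd ((F , refl , col) , _) = +-cancelʳ-≤ (2 * count H) s (2 * count F) (begin
    s + 2 * count H              ≡⟨ cong (_+ 2 * count H) (sym Δ≡s) ⟩
    Δ G + 2 * count H            ≤⟨ colourable-size H col odd ⟩
    Δ G * n G                    ≡⟨ cong (_* n G) Δ≡s ⟩
    s * n G                      ≡⟨ *-comm (n G) s ⟨
    n G * s                      ≡⟨ regular-size reg ⟨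
    2 * m G                      ≡⟨ cong (2 *_) (count-compl F) ⟨
    2 * (count H + count F)      ≡⟨ *-distribˡ-+ 2 (count H) (count F) ⟩
    2 * count H + 2 * count F    ≡⟨ +-comm (2 * count H) (2 * count F) ⟩
    2 * count F + 2 * count H    ∎)
    where
    open ≤-Reasoning
    H : EdgeSet G
    H = remove G F
    Δ≡s : Δ G ≡ s
    Δ≡s = regular⇒Δ≡ reg (odd⇒Fin odd)

-- Each class is counted once, through its least element, as in oddComponents.
module EquivalenceClasses {N : ℕ} (R : Fin N → Fin N → Bool)
  (R-refl  : ∀ u → T (R u u))
  (R-sym   : ∀ u v → T (R u v) → T (R v u))
  (R-trans : ∀ u v w → T (R u v) → T (R v w) → T (R u w)) where

  isLeast : Fin N → Bool
  isLeast u = allF (λ w → not ((toℕ w <ᵇ toℕ u) ∧ R w u))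

  unique-least : ∀ v → count (λ u → isLeast u ∧ R u v) ≡ 1
  unique-least v with least-witness (λ w → R w v) v (R-refl v)
  ... | u₀ , u₀v , minimal = count-one _ u₀ (T-∧⁺ u₀-least u₀v) only-u₀
    where
    u₀-least : T (isLeast u₀)
    u₀-least = allF-intro _ λ w → T-not⁺ λ q →
      minimal w (<ᵇ⇒< _ _ (proj₁ (T-∧⁻ q))) (R-trans w u₀ v (proj₂ (T-∧⁻ {toℕ w <ᵇ toℕ u₀} q)) u₀v)
    only-u₀ : ∀ u → T (isLeast u ∧ R u v) → u ≡ u₀
    only-u₀ u q with T-∧⁻ {isLeast u} q
    ... | u-least , uv with <-cmp (toℕ u) (toℕ u₀)
    ...   | tri< u<u₀ _ _ = ⊥-elim (minimal u u<u₀ uv)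
    ...   | tri≈ _ u≡u₀ _ = toℕ-injective u≡u₀
    ...   | tri> _ _ u₀<u = ⊥-elim (T-not⁻ (allF-elim _ u-least u₀)
                                     (T-∧⁺ (<⇒<ᵇ u₀<u) (R-trans u₀ v u u₀v (R-sym u v uv))))

  classes-partition : N ≡ sumF (λ u → if isLeast u then count (R u) else 0)
  classes-partition = begin
    N                                                    ≡⟨ sumF-ones N ⟨
    sumF {N} (λ _ → 1)                                   ≡⟨ sumF-ext _ _ (λ v → sym (unique-least v)) ⟩
    sumF (λ v → count (λ u → isLeast u ∧ R u v))         ≡⟨ sumF-count-swap (λ u v → isLeast u ∧ R u v) ⟩
    sumF (λ u → count (λ v → isLeast u ∧ R u v))         ≡⟨ sumF-ext _ _ (λ u → count-∧ˡ (isLeast u) (R u)) ⟩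
    sumF (λ u → if isLeast u then count (R u) else 0)    ∎
    where open ≡-Reasoning

  odd-class : N % 2 ≡ 1 → 0 < count (λ u → isLeast u ∧ (count (R u) % 2 ≡ᵇ 1))
  odd-class odd with any? (λ u → T? (isLeast u ∧ (count (R u) % 2 ≡ᵇ 1)))
  ... | yes (u , p) = count-pos _ u p
  ... | no none = ⊥-elim (odd⇒¬2∣ odd (subst (2 ∣_) (sym classes-partition) (sumF-∣ _ even-class)))
    where
    even-class : ∀ u → 2 ∣ (if isLeast u then count (R u) else 0)
    even-class u with isLeast u in eq
    ... | false = 2 ∣0
    ... | true  = ¬odd⇒2∣ _ (λ e → none (u , T-∧⁺ (subst T (sym eq) tt) (≡⇒≡ᵇ _ 1 e)))

module _ (G : Multigraph) (H : EdgeSet G) where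

  private
    R : ℕ → Fin (n G) → Fin (n G) → Bool
    R = reachWithin G H

  adj-sym : ∀ u v → T (adj G H u v) → T (adj G H v u)
  adj-sym u v p with anyF-elim _ p
  ... | e , q with T-∧⁻ {H e} q
  ...   | h , ends-uv = anyF-intro _ e (T-∧⁺ h (T-∨-comm (x == u ∧ y == v) (x == v ∧ y == u) ends-uv))
    where
    x y : Fin (n G)
    x = proj₁ (ends G e)
    y = proj₂ (ends G e)

  reachWithin-suc : ∀ k {u v} → T (R k u v) → T (R (suc k) u v)
  reachWithin-suc k = T-∨⁺ˡ

  reachWithin-snoc : ∀ k {u w v} → T (R k u w) → T (adj G H w v) → T (R (suc k) u v)
  reachWithin-snoc k {u} {w} {v} p q =
    T-∨⁺ʳ {R k u v} (anyF-intro (λ x → R k u x ∧ adj G H x v) w (T-∧⁺ p q))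

  reachWithin-refl : ∀ k u → T (R k u u)
  reachWithin-refl zero    u = ==-refl u
  reachWithin-refl (suc k) u = reachWithin-suc k (reachWithin-refl k u)

  reachWithin-++ : ∀ a b {u v w} → T (R a u v) → T (R b v w) → T (R (b + a) u w)
  reachWithin-++ a zero p q with ==⇒≡ q
  ... | refl = p
  reachWithin-++ a (suc b) {u} {v} {w} p q with T-∨⁻ {R b v w} q
  ... | inj₁ q' = reachWithin-suc (b + a) (reachWithin-++ a b p q')
  ... | inj₂ q' with anyF-elim _ q'
  ...   | x , r with T-∧⁻ {R b v x} r
  ...     | vx , xw = reachWithin-snoc (b + a) (reachWithin-++ a b p vx) xw

  reachWithin-sym : ∀ k {u v} → T (R k u v) → T (R k v u)
  reachWithin-sym zero p with ==⇒≡ p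
  ... | refl = p
  reachWithin-sym (suc k) {u} {v} p with T-∨⁻ {R k u v} p
  ... | inj₁ q = reachWithin-suc k (reachWithin-sym k q)
  ... | inj₂ q with anyF-elim _ q
  ...   | w , r with T-∧⁻ {R k u w} r
  ...     | uw , wv = subst (λ l → T (R l v u)) (+-comm k 1)
                        (reachWithin-++ 1 k (reachWithin-snoc 0 (reachWithin-refl 0 v) (adj-sym w v wv))
                                            (reachWithin-sym k uw))

  -- reach only follows walks of length ≤ n, so its transitivity needs an
  -- argument: the set reachable from u within k steps grows strictly until it
  -- stops growing, and it has at most n elements, so it is stable from k = n on.
  Stable : Fin (n G) → ℕ → Set
  Stable u k = ∀ v → T (R (suc k) u v) → T (R k u v)

  stable-suc : ∀ {u k} → Stable u k → Stable u (suc k)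
  stable-suc {u} {k} st v p with T-∨⁻ {R (suc k) u v} p
  ... | inj₁ q = q
  ... | inj₂ q with anyF-elim _ q
  ...   | w , r with T-∧⁻ {R (suc k) u w} r
  ...     | uw , wv = reachWithin-snoc k (st w uw) wv

  stable-+ : ∀ {u k} → Stable u k → ∀ j → Stable u (j + k)
  stable-+ st zero    = st
  stable-+ {u} {k} st (suc j) = stable-suc {u} {j + k} (stable-+ st j)

  stable-collapse : ∀ {u k} → Stable u k → ∀ j v → T (R (j + k) u v) → T (R k u v)
  stable-collapse st zero    v p = p
  stable-collapse st (suc j) v p = stable-collapse st j v (stable-+ st j v p)

  stable-or-grows : ∀ u k → Stable u k ⊎ ∃ λ v → T (R (suc k) u v) × ¬ T (R k u v)
  stable-or-grows u k with any? (λ v → T? (R (suc k) u v) ×-dec ¬? (T? (R k u v)))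
  ... | yes grows = inj₂ grows
  ... | no stuck  = inj₁ λ v p → decidable-stable (T? (R k u v)) (λ ¬q → stuck (v , p , ¬q))

  stable-or-large : ∀ u k → Stable u k ⊎ k < count (R k u)
  stable-or-large u zero = inj₂ (count-pos (R 0 u) u (==-refl u))
  stable-or-large u (suc k) with stable-or-grows u k
  ... | inj₁ st = inj₁ (stable-suc {u} {k} st)
  ... | inj₂ (v , p , ¬p) with stable-or-large u k
  ...   | inj₁ st    = ⊥-elim (¬p (st v p))
  ...   | inj₂ large = inj₂ (<-≤-trans (s≤s large) (count-⊂ (R k u) (R (suc k) u) (λ _ → reachWithin-suc k) v p ¬p))

  stable-at-order : ∀ u → Stable u (n G)
  stable-at-order u with stable-or-large u (n G)
  ... | inj₁ st    = st
  ... | inj₂ large = ⊥-elim (<⇒≱ large (count≤ (R (n G) u)))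

  reach-trans : ∀ u v w → T (reach G H u v) → T (reach G H v w) → T (reach G H u w)
  reach-trans u v w p q = stable-collapse (stable-at-order u) (n G) w (reachWithin-++ (n G) (n G) p q)

  oddComponents-pos : n G % 2 ≡ 1 → 0 < oddComponents G H
  oddComponents-pos = EquivalenceClasses.odd-class (reach G H) (reachWithin-refl (n G))
                                                   (λ _ _ → reachWithin-sym (n G)) reach-trans

module _ (G : Multigraph) where

  oddCycles-bound : n G % 2 ≡ 1 → ∀ {k} H (f : Fin (m G) → Fin k) → k ≤ oddCycles G H f
  oddCycles-bound odd {k} H f = begin
    k                                                ≡⟨ sumF-ones k ⟨
    sumF {k} (λ _ → 1)                               ≤⟨ sumF-mono _ _ (λ i → oddComponents-pos G (factor G H f i) odd) ⟩
    sumF (λ i → oddComponents G (factor G H f i))    ∎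
    where open ≤-Reasoning

  oddness-bound : ∀ {s j} → n G % 2 ≡ 1 → IsOddness G s (fin j) → s ≤ 2 * j
  oddness-bound {s} odd (even-case , odd-case) with half s
  ... | k , inj₁ refl with even-case k refl
  ...   | (f , _ , refl) , _ = *-monoʳ-≤ 2 (oddCycles-bound odd (allEdges G) f)
  oddness-bound {s} odd (even-case , odd-case) | k , inj₂ refl with odd-case k refl
  ...   | inj₁ ((F₁ , F₁-perfect , _) , _) = ⊥-elim (odd⇒no-1-factor G odd F₁ F₁-perfect)
  ...   | inj₂ (_ , ())

proposition2p5 : (G : Multigraph) (s : ℕ) → Connected G → Regular G s → n G % 2 ≡ 1
                 → (∀ r → IsResistance G r → s ≤ 2 * r)
                   × (∀ j → IsOddness G s (fin j) → s ≤ 2 * j)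
proposition2p5 G s _ regular odd = (λ _ → resistance-bound G regular odd) , (λ _ → oddness-bound G odd)
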